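{- (a) $x\cdot\mathbb{N}[x]\setminus\{0\}\subseteq\mathfrak{S}$. (b) $x\cdot\mathsf{RTN}_1\subseteq x\cdot\mathsf{RTN}_1{}^\star\subseteq\mathfrak{S}$. (c) $\mathfrak{S}$ contains $x$ and $x/(1-x^m)$ for every $m\ge1$, and is closed under multiplication by positive integers, addition and Cauchy product.
   Context: For $\mathbf{R}(x)=\sum r(n)x^n\in\mathbb{R}[[x]]$: $\mathbf{R}\in\mathsf{RT}_1$ iff $r(n)>0$ for all sufficiently large $n$ and $r(n-1)/r(n)\to1$; $\mathsf{RT}_1{}^\star=\{\mathbf{R}(x^d):\mathbf{R}\in\mathsf{RT}_1,\ d\ge1\text{ integer}\}$; $\mathsf{RTN}_1=\mathsf{RT}_1\cap\mathbb{N}[[x]]$ and $\mathsf{RTN}_1{}^\star=\mathsf{RT}_1{}^\star\cap\mathbb{N}[[x]]$. $\mathfrak{S}$ is the set of power series $\mathbf{P}(x)\in x\cdot\mathbb{N}[[x]]\setminus\{0\}$ expressible as $\mathbf{p}_0(x)+\sum_{i=1}^k\mathbf{p}_i(x)\mathbf{R}_i(x^{\mathfrak{d}_i})$ with $\mathbf{p}_i(x)\in\mathbb{N}[x]$, $\mathbf{R}_i(x)\in\mathsf{RTN}_1$ and $\mathfrak{d}_i$ positive integers. -}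

module Defs where

open import Data.Nat using (ℕ; zero; suc; _+_; _*_; _∸_; _≤_; _<_; NonZero)
open import Data.Nat.Divisibility using (_∣?_)
open import Data.Nat.DivMod using (_/_)
open import Data.Integer using (+_)
open import Data.Rational as ℚ using (ℚ; 0ℚ; 1ℚ; ∣_∣; _-_)
open import Data.List using (List; []; _∷_)
open import Data.Fin using (Fin)
open import Data.Product using (Σ; ∃; _×_)
open import Relation.Nullary using (¬_; yes; no)
open import Relation.Binary.PropositionalEquality using (_≡_)

Series : Set
Series = ℕ → ℕ

_≐_ : Series → Series → Set
P ≐ Q = ∀ n → P n ≡ Q n

IsZero : Series → Set
IsZero P = ∀ n → P n ≡ 0

-- Polynomials in ℕ[x] : coefficient lists (constant term first).
Poly : Set
Poly = List ℕ

coeff : Poly → Series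
coeff []       n       = 0
coeff (a ∷ p)  zero    = a
coeff (a ∷ p)  (suc n) = coeff p n

ΣFin : (k : ℕ) → (Fin k → ℕ) → ℕ
ΣFin zero    f = 0
ΣFin (suc k) f = f Fin.zero + ΣFin k (λ i → f (Fin.suc i))

Σ≤ : ℕ → (ℕ → ℕ) → ℕ
Σ≤ zero    f = f 0
Σ≤ (suc n) f = Σ≤ n f + f (suc n)

xTimes : Series → Series
xTimes P zero    = 0
xTimes P (suc n) = P n

scale : ℕ → Series → Series
scale c P n = c * P n

_⊕_ : Series → Series → Series
(P ⊕ Q) n = P n + Q n

_⊛_ : Series → Series → Series
(P ⊛ Q) n = Σ≤ n (λ i → P i * Q (n ∸ i))

-- R(x^d) : coefficient of x^m is R(m/d) if d ∣ m, else 0 (d = 0 never used).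
dilate : Series → ℕ → Series
dilate R zero    m = 0
dilate R (suc e) m with suc e ∣? m
... | yes _ = R (m / suc e)
... | no  _ = 0

xSeries : Series
xSeries zero          = 0
xSeries (suc zero)    = 1
xSeries (suc (suc n)) = 0

-- x / (1 - x^m) = Σ_{q ≥ 0} x^{1 + q m}
geomX : ℕ → Series
geomX m = xTimes (dilate (λ _ → 1) m)

-- RT_1 restricted to ℕ-coefficients (i.e. RTN_1):
-- r(n) > 0 eventually, and r(n-1)/r(n) → 1 (limit expressed over ℚ;
-- the ratio r(m)/r(m+1) is taken whenever r(m+1) ≠ 0).
RTN₁ : Series → Set
RTN₁ r =
  (∃ λ N → ∀ n → N ≤ n → 0 < r n) ×
  (∀ (ε : ℚ) → 0ℚ ℚ.< ε → ∃ λ M → ∀ m → M ≤ m → (nz : NonZero (r (suc m))) →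
     ∣ ((+ r m) ℚ./ r (suc m)) {{nz}} - 1ℚ ∣ ℚ.< ε)

RTN₁⋆ : Series → Set
RTN₁⋆ P = Σ Series λ R → Σ ℕ λ d → 1 ≤ d × RTN₁ R × (P ≐ dilate R d)

InXRTN₁ : Series → Set
InXRTN₁ P = Σ Series λ R → RTN₁ R × (P ≐ xTimes R)

InXRTN₁⋆ : Series → Set
InXRTN₁⋆ P = Σ Series λ R → RTN₁⋆ R × (P ≐ xTimes R)

polyDil : Poly → Series → ℕ → Series
polyDil p R d n = Σ≤ n (λ j → coeff p j * dilate R d (n ∸ j))

InS : Series → Set
InS P =
  (P 0 ≡ 0) × (¬ IsZero P) ×
  (Σ Poly λ p₀ → Σ ℕ λ k → Σ (Fin k → Poly) λ ps →
     Σ (Fin k → Series) λ Rs → Σ (Fin k → ℕ) λ ds →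
       (∀ i → RTN₁ (Rs i)) × (∀ i → 1 ≤ ds i) ×
       (∀ n → P n ≡ coeff p₀ n + ΣFin k (λ i → polyDil (ps i) (Rs i) (ds i) n)))

module Submission where

-- Write A(x^(e+1)) for the dilation of a series A.  The substance is
-- closure under the Cauchy product.  Apart from its normalisation
-- conditions, membership in 𝔖 says that a series is a finite sum of "atoms"
-- x^j and x^j·T(x^(e+1)) with T ∈ RTN₁; we generate these sums inductively
-- (Span) and prove that Span is closed under products.  For two dilated
-- atoms T(x^d), S(x^f) we split each into residue sections,
--   T(x^d) = Σ_{u<f} x^(d·u) · T_u(x^(d·f)),   T_u(n) = T(u + n·f),
-- so that both become sums of dilations with the common step d·f, and use
-- A(x^(df)) · B(x^(df)) = (A·B)(x^(df)).  What remains is that RTN₁ is closed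
-- under sections and Cauchy products.  We prove this for an equivalent
-- ratio condition RT stated with natural-number inequalities only; the
-- equivalence RT ⇔ RTN₁ is a computation with rationals.

open import Defs
open import Data.Nat
open import Data.Nat.Properties
open import Data.Nat.Divisibility using (divides; _∣?_; m%n≡0⇒n∣m)
open import Data.Nat.DivMod using (_/_; _%_; m≡m%n+[m/n]*n; m%n<n; m*n/n≡m)
open import Data.Nat.Solver using (module +-*-Solver)
open import Data.Integer as ℤ using (ℤ; -[1+_]; _⊖_)
import Data.Integer.Properties as ℤP
open import Data.Rational as ℚ using (ℚ; mkℚ; 0ℚ; 1ℚ; toℚᵘ)
import Data.Rational.Properties as ℚP
open import Data.Rational.Unnormalised as ℚᵘ using (ℚᵘ; mkℚᵘ)
import Data.Rational.Unnormalised.Properties as ℚᵘP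
open import Data.Nat.Coprimality using (Coprime)
open import Data.List using ([]; _∷_)
open import Data.Fin using (Fin; zero; suc)
open import Data.Product using (Σ; ∃; _×_; _,_; proj₁; proj₂)
open import Data.Sum using (_⊎_; inj₁; inj₂; [_,_]′)
open import Data.Empty using (⊥-elim)
open import Relation.Nullary using (¬_; yes; no)
open import Relation.Binary.PropositionalEquality
open import Function using (_∘_)
open import Algebra.Properties.CommutativeSemigroup +-commutativeSemigroup using (interchange)
open +-*-Solver

-- Series algebra

𝟘 : Series
𝟘 _ = 0

𝟙 : Series
𝟙 zero    = 1
𝟙 (suc _) = 0

shift : ℕ → Series → Series
shift zero    F = F
shift (suc j) F = xTimes (shift j F)

≐-refl : ∀ {F} → F ≐ F
≐-refl n = refl

≐-sym : ∀ {F G} → F ≐ G → G ≐ F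
≐-sym e n = sym (e n)

≐-trans : ∀ {F G H} → F ≐ G → G ≐ H → F ≐ H
≐-trans e f n = trans (e n) (f n)

xTimes-cong : ∀ {A B} → A ≐ B → xTimes A ≐ xTimes B
xTimes-cong e zero    = refl
xTimes-cong e (suc n) = e n

shift-cong : ∀ j {A B} → A ≐ B → shift j A ≐ shift j B
shift-cong zero    e = e
shift-cong (suc j) e = xTimes-cong (shift-cong j e)

⊕-cong : ∀ {A A' B B'} → A ≐ A' → B ≐ B' → (A ⊕ B) ≐ (A' ⊕ B')
⊕-cong e f n = cong₂ _+_ (e n) (f n)

shift-+ : ∀ a b F → shift (a + b) F ≐ shift a (shift b F)
shift-+ zero    b F = ≐-refl
shift-+ (suc a) b F = xTimes-cong (shift-+ a b F)

shift-⊕ : ∀ j A B → shift j (A ⊕ B) ≐ (shift j A ⊕ shift j B)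
shift-⊕ zero    A B         = ≐-refl
shift-⊕ (suc j) A B zero    = refl
shift-⊕ (suc j) A B (suc n) = shift-⊕ j A B n

shift-𝟘 : ∀ j → shift j 𝟘 ≐ 𝟘
shift-𝟘 zero    = ≐-refl
shift-𝟘 (suc j) zero    = refl
shift-𝟘 (suc j) (suc n) = shift-𝟘 j n

shift-scale : ∀ j c A → shift j (scale c A) ≐ scale c (shift j A)
shift-scale zero    c A         = ≐-refl
shift-scale (suc j) c A zero    = sym (*-zeroʳ c)
shift-scale (suc j) c A (suc n) = shift-scale j c A n

-- The coefficient of x^m in x^j·A only depends on A at index m ∸ j; stated
-- in this form it supports inductions on the index.
shift-local : ∀ j {A B} m → (∀ i → i + j ≡ m → A i ≡ B i) → shift j A m ≡ shift j B m
shift-local zero    m       e = e m (+-identityʳ m)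
shift-local (suc j) zero    e = refl
shift-local (suc j) (suc m) e = shift-local j m (λ i eq → e i (trans (+-suc i j) (cong suc eq)))

Σ≤-cong : ∀ n {f g : ℕ → ℕ} → (∀ i → i ≤ n → f i ≡ g i) → Σ≤ n f ≡ Σ≤ n g
Σ≤-cong zero    e = e 0 z≤n
Σ≤-cong (suc n) e = cong₂ _+_ (Σ≤-cong n (λ i i≤n → e i (m≤n⇒m≤1+n i≤n))) (e (suc n) ≤-refl)

Σ≤-mono : ∀ n {f g : ℕ → ℕ} → (∀ i → i ≤ n → f i ≤ g i) → Σ≤ n f ≤ Σ≤ n g
Σ≤-mono zero    e = e 0 z≤n
Σ≤-mono (suc n) e = +-mono-≤ (Σ≤-mono n (λ i i≤n → e i (m≤n⇒m≤1+n i≤n))) (e (suc n) ≤-refl)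

Σ≤-zero : ∀ n {f : ℕ → ℕ} → (∀ i → i ≤ n → f i ≡ 0) → Σ≤ n f ≡ 0
Σ≤-zero zero    e = e 0 z≤n
Σ≤-zero (suc n) e = cong₂ _+_ (Σ≤-zero n (λ i i≤n → e i (m≤n⇒m≤1+n i≤n))) (e (suc n) ≤-refl)

Σ≤-+ : ∀ n (f g : ℕ → ℕ) → Σ≤ n (λ i → f i + g i) ≡ Σ≤ n f + Σ≤ n g
Σ≤-+ zero    f g = refl
Σ≤-+ (suc n) f g = trans (cong (_+ (f (suc n) + g (suc n))) (Σ≤-+ n f g))
                         (interchange (Σ≤ n f) (Σ≤ n g) (f (suc n)) (g (suc n)))

Σ≤-* : ∀ n c (f : ℕ → ℕ) → Σ≤ n (λ i → c * f i) ≡ c * Σ≤ n f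
Σ≤-* zero    c f = refl
Σ≤-* (suc n) c f = trans (cong (_+ c * f (suc n)) (Σ≤-* n c f)) (sym (*-distribˡ-+ c (Σ≤ n f) (f (suc n))))

Σ≤-suc : ∀ n (f : ℕ → ℕ) → Σ≤ (suc n) f ≡ f 0 + Σ≤ n (f ∘ suc)
Σ≤-suc zero    f = refl
Σ≤-suc (suc n) f = trans (cong (_+ f (suc (suc n))) (Σ≤-suc n f)) (+-assoc (f 0) (Σ≤ n (f ∘ suc)) (f (suc (suc n))))

Σ≤-term : ∀ n (f : ℕ → ℕ) i → i ≤ n → f i ≤ Σ≤ n f
Σ≤-term zero    f .zero z≤n = ≤-refl
Σ≤-term (suc n) f i i≤ with m≤n⇒m<n∨m≡n i≤
... | inj₁ i<   = ≤-trans (Σ≤-term n f i (≤-pred i<)) (m≤m+n _ _)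
... | inj₂ refl = m≤n+m _ _

Σ≤-extend : ∀ n t (f : ℕ → ℕ) → Σ≤ n f ≤ Σ≤ (n + t) f
Σ≤-extend n zero    f = ≤-reflexive (cong (λ z → Σ≤ z f) (sym (+-identityʳ n)))
Σ≤-extend n (suc t) f = ≤-trans (≤-trans (Σ≤-extend n t f) (m≤m+n _ _)) (≤-reflexive (cong (λ z → Σ≤ z f) (sym (+-suc n t))))

Σ≤-window : ∀ p q (f : ℕ → ℕ) → Σ≤ q (λ j → f (p + j)) ≤ Σ≤ (p + q) f
Σ≤-window zero    q f = ≤-refl
Σ≤-window (suc p) q f = ≤-trans (≤-trans (Σ≤-window p q (f ∘ suc)) (m≤n+m _ _)) (≤-reflexive (sym (Σ≤-suc (p + q) f)))

Σ≤-split : ∀ p q (f : ℕ → ℕ) → Σ≤ (p + suc q) f ≡ Σ≤ p f + Σ≤ q (λ j → f (p + suc j))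
Σ≤-split p zero    f rewrite +-suc p 0 | +-identityʳ p = refl
Σ≤-split p (suc q) f rewrite +-suc p (suc q) | Σ≤-split p q f = +-assoc (Σ≤ p f) _ _

Σ≤-split-overlap : ∀ p q (f : ℕ → ℕ) → Σ≤ p f + Σ≤ q (λ j → f (p + j)) ≡ Σ≤ (p + q) f + f p
Σ≤-split-overlap p zero    f rewrite +-identityʳ p = refl
Σ≤-split-overlap p (suc q) f rewrite +-suc p q = begin
    Σ≤ p f + (Σ≤ q (λ j → f (p + j)) + f (suc (p + q))) ≡⟨ sym (+-assoc (Σ≤ p f) _ _) ⟩
    Σ≤ p f + Σ≤ q (λ j → f (p + j)) + f (suc (p + q))   ≡⟨ cong (_+ f (suc (p + q))) (Σ≤-split-overlap p q f) ⟩
    Σ≤ (p + q) f + f p + f (suc (p + q))                  ≡⟨ +-assoc (Σ≤ (p + q) f) _ _ ⟩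
    Σ≤ (p + q) f + (f p + f (suc (p + q)))                ≡⟨ cong (Σ≤ (p + q) f +_) (+-comm (f p) _) ⟩
    Σ≤ (p + q) f + (f (suc (p + q)) + f p)                ≡⟨ sym (+-assoc (Σ≤ (p + q) f) _ _) ⟩
    Σ≤ (suc (p + q)) f + f p ∎
  where open ≡-Reasoning

sumS : ℕ → (ℕ → Series) → Series
sumS zero    F = 𝟘
sumS (suc j) F = F 0 ⊕ sumS j (F ∘ suc)

sumS-last : ∀ j G → sumS (suc j) G ≐ (sumS j G ⊕ G j)
sumS-last zero    G n = +-comm (G 0 n) 0
sumS-last (suc j) G n = trans (cong (G 0 n +_) (sumS-last j (G ∘ suc) n)) (sym (+-assoc (G 0 n) _ _))

sumS-cong : ∀ j {F G} → (∀ u → F u ≐ G u) → sumS j F ≐ sumS j G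
sumS-cong zero    e = ≐-refl
sumS-cong (suc j) e = ⊕-cong (e 0) (sumS-cong j (λ u → e (suc u)))

shift-sumS : ∀ a j F → shift a (sumS j F) ≐ sumS j (λ u → shift a (F u))
shift-sumS a zero    F = shift-𝟘 a
shift-sumS a (suc j) F = ≐-trans (shift-⊕ a _ _) (⊕-cong ≐-refl (shift-sumS a j (F ∘ suc)))

∸-suc : ∀ {n i} → i ≤ n → suc n ∸ i ≡ suc (n ∸ i)
∸-suc = +-∸-assoc 1

⊛-cong : ∀ {F F' G G'} → F ≐ F' → G ≐ G' → (F ⊛ G) ≐ (F' ⊛ G')
⊛-cong e f n = Σ≤-cong n (λ i _ → cong₂ _*_ (e i) (f (n ∸ i)))

⊛-distribˡ : ∀ F G H → (F ⊛ (G ⊕ H)) ≐ ((F ⊛ G) ⊕ (F ⊛ H))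
⊛-distribˡ F G H n = trans (Σ≤-cong n (λ i _ → *-distribˡ-+ (F i) (G (n ∸ i)) (H (n ∸ i)))) (Σ≤-+ n _ _)

⊛-distribʳ : ∀ F G H → ((G ⊕ H) ⊛ F) ≐ ((G ⊛ F) ⊕ (H ⊛ F))
⊛-distribʳ F G H n = trans (Σ≤-cong n (λ i _ → *-distribʳ-+ (F (n ∸ i)) (G i) (H i))) (Σ≤-+ n _ _)

⊛-zeroˡ : ∀ G → (𝟘 ⊛ G) ≐ 𝟘
⊛-zeroˡ G n = Σ≤-zero n (λ i _ → refl)

⊛-zeroʳ : ∀ G → (G ⊛ 𝟘) ≐ 𝟘
⊛-zeroʳ G n = Σ≤-zero n (λ i _ → *-zeroʳ (G i))

⊛-identityˡ : ∀ G → (𝟙 ⊛ G) ≐ G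
⊛-identityˡ G zero    = +-identityʳ (G 0)
⊛-identityˡ G (suc n) = trans (Σ≤-suc n _)
  (trans (cong₂ _+_ (+-identityʳ (G (suc n))) (Σ≤-zero n (λ i _ → refl))) (+-identityʳ _))

⊛-identityʳ : ∀ G → (G ⊛ 𝟙) ≐ G
⊛-identityʳ G zero    = *-identityʳ (G 0)
⊛-identityʳ G (suc n) = cong₂ _+_
  (Σ≤-zero n (λ i i≤n → trans (cong (λ z → G i * 𝟙 z) (∸-suc i≤n)) (*-zeroʳ (G i))))
  (trans (cong (λ z → G (suc n) * 𝟙 z) (n∸n≡0 n)) (*-identityʳ _))

⊛-suc : ∀ A B → ((A ⊛ B) ∘ suc) ≐ (scale (A 0) (B ∘ suc) ⊕ ((A ∘ suc) ⊛ B))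
⊛-suc A B n = Σ≤-suc n _

⊛-xˡ : ∀ F G → (xTimes F ⊛ G) ≐ xTimes (F ⊛ G)
⊛-xˡ F G zero    = refl
⊛-xˡ F G (suc n) = Σ≤-suc n _

⊛-xʳ : ∀ F G → (F ⊛ xTimes G) ≐ xTimes (F ⊛ G)
⊛-xʳ F G zero    = *-zeroʳ (F 0)
⊛-xʳ F G (suc n) = begin
    Σ≤ n (λ i → F i * xTimes G (suc n ∸ i)) + F (suc n) * xTimes G (n ∸ n)
      ≡⟨ cong₂ _+_ (Σ≤-cong n (λ i i≤n → cong (λ z → F i * xTimes G z) (∸-suc i≤n)))
                   (trans (cong (λ z → F (suc n) * xTimes G z) (n∸n≡0 n)) (*-zeroʳ (F (suc n)))) ⟩
    Σ≤ n (λ i → F i * G (n ∸ i)) + 0 ≡⟨ +-identityʳ _ ⟩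
    Σ≤ n (λ i → F i * G (n ∸ i)) ∎
  where open ≡-Reasoning

⊛-shiftˡ : ∀ j F G → (shift j F ⊛ G) ≐ shift j (F ⊛ G)
⊛-shiftˡ zero    F G = ≐-refl
⊛-shiftˡ (suc j) F G = ≐-trans (⊛-xˡ (shift j F) G) (xTimes-cong (⊛-shiftˡ j F G))

⊛-shiftʳ : ∀ j F G → (F ⊛ shift j G) ≐ shift j (F ⊛ G)
⊛-shiftʳ zero    F G = ≐-refl
⊛-shiftʳ (suc j) F G = ≐-trans (⊛-xʳ F (shift j G)) (xTimes-cong (⊛-shiftʳ j F G))

⊛-shift : ∀ j l A B → (shift j A ⊛ shift l B) ≐ shift j (shift l (A ⊛ B))
⊛-shift j l A B = ≐-trans (⊛-shiftˡ j A (shift l B)) (shift-cong j (⊛-shiftʳ l A B))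

-- Dilations

-- dilFrom A e k is x^k · A(x^(e+1)): it emits the coefficients of A, each
-- followed by e zeros.  The recursion makes all dilation identities provable
-- by induction on the index.
dilFrom : Series → ℕ → ℕ → Series
dilFrom A e zero    zero    = A 0
dilFrom A e zero    (suc m) = dilFrom (A ∘ suc) e e m
dilFrom A e (suc k) zero    = 0
dilFrom A e (suc k) (suc m) = dilFrom A e k m

-- dil A e = A(x^(e+1)).
dil : Series → ℕ → Series
dil A e = dilFrom A e 0

dilFrom-shift : ∀ A e k → dilFrom A e k ≐ shift k (dil A e)
dilFrom-shift A e zero            = ≐-refl
dilFrom-shift A e (suc k) zero    = refl
dilFrom-shift A e (suc k) (suc m) = dilFrom-shift A e k m

dilFrom-skip : ∀ A e k m → dilFrom A e k (k + m) ≡ dil A e m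
dilFrom-skip A e zero    m = refl
dilFrom-skip A e (suc k) m = dilFrom-skip A e k m

dilFrom-gap : ∀ A e k m → m < k → dilFrom A e k m ≡ 0
dilFrom-gap A e (suc k) zero    _         = refl
dilFrom-gap A e (suc k) (suc m) (s≤s m<k) = dilFrom-gap A e k m m<k

dilFrom-cong : ∀ {A B} e k → A ≐ B → dilFrom A e k ≐ dilFrom B e k
dilFrom-cong e zero    eq zero    = eq 0
dilFrom-cong e zero    eq (suc m) = dilFrom-cong e e (λ n → eq (suc n)) m
dilFrom-cong e (suc k) eq zero    = refl
dilFrom-cong e (suc k) eq (suc m) = dilFrom-cong e k eq m

dilFrom-⊕ : ∀ A B e k → dilFrom (A ⊕ B) e k ≐ (dilFrom A e k ⊕ dilFrom B e k)
dilFrom-⊕ A B e zero    zero    = refl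
dilFrom-⊕ A B e zero    (suc m) = dilFrom-⊕ (A ∘ suc) (B ∘ suc) e e m
dilFrom-⊕ A B e (suc k) zero    = refl
dilFrom-⊕ A B e (suc k) (suc m) = dilFrom-⊕ A B e k m

dilFrom-scale : ∀ c A e k → dilFrom (scale c A) e k ≐ scale c (dilFrom A e k)
dilFrom-scale c A e zero    zero    = refl
dilFrom-scale c A e zero    (suc m) = dilFrom-scale c (A ∘ suc) e e m
dilFrom-scale c A e (suc k) zero    = sym (*-zeroʳ c)
dilFrom-scale c A e (suc k) (suc m) = dilFrom-scale c A e k m

dil-suc : ∀ A e m → dil A e (suc m) ≡ shift e (dil (A ∘ suc) e) m
dil-suc A e m = dilFrom-shift (A ∘ suc) e e m

dil-rec : ∀ A e → dil A e ≐ (scale (A 0) 𝟙 ⊕ shift (suc e) (dil (A ∘ suc) e))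
dil-rec A e zero    = sym (trans (+-identityʳ _) (*-identityʳ (A 0)))
dil-rec A e (suc m) = trans (dil-suc A e m) (cong (_+ shift e (dil (A ∘ suc) e) m) (sym (*-zeroʳ (A 0))))

dil-cong : ∀ {A B} e → A ≐ B → dil A e ≐ dil B e
dil-cong e = dilFrom-cong e 0

dil-zero : ∀ A → dil A 0 ≐ A
dil-zero A zero    = refl
dil-zero A (suc m) = dil-zero (A ∘ suc) m

dil-multiple : ∀ A e n → dil A e (n * suc e) ≡ A n
dil-multiple A e zero    = refl
dil-multiple A e (suc n) = trans (dilFrom-skip (A ∘ suc) e e (n * suc e)) (dil-multiple (A ∘ suc) e n)

dil-nonmultiple : ∀ A e n r → r < e → dil A e (suc r + n * suc e) ≡ 0
dil-nonmultiple A e zero    r r<e =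
  trans (cong (dilFrom (A ∘ suc) e e) (+-identityʳ r)) (dilFrom-gap (A ∘ suc) e e r r<e)
dil-nonmultiple A e (suc n) r r<e = begin
    dilFrom (A ∘ suc) e e (r + (suc e + n * suc e)) ≡⟨ cong (dilFrom (A ∘ suc) e e) index ⟩
    dilFrom (A ∘ suc) e e (e + suc (r + n * suc e)) ≡⟨ dilFrom-skip (A ∘ suc) e e _ ⟩
    dil (A ∘ suc) e (suc r + n * suc e)             ≡⟨ dil-nonmultiple (A ∘ suc) e n r r<e ⟩
    0 ∎
  where
  open ≡-Reasoning
  index : r + (suc e + n * suc e) ≡ e + suc (r + n * suc e)
  index = solve 3 (λ r e x → r :+ ((con 1 :+ e) :+ x) := e :+ (con 1 :+ (r :+ x))) refl r e (n * suc e)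

dilate≐dil : ∀ A e → dilate A (suc e) ≐ dil A e
dilate≐dil A e m with suc e ∣? m
... | yes (divides q eq) rewrite eq = trans (cong A (m*n/n≡m q (suc e))) (sym (dil-multiple A e q))
... | no ¬d = sym (off-multiple (m % suc e) refl)
  where
  off-multiple : ∀ r → m % suc e ≡ r → dil A e m ≡ 0
  off-multiple zero    eq = ⊥-elim (¬d (m%n≡0⇒n∣m m (suc e) eq))
  off-multiple (suc r) eq =
    trans (cong (dil A e) (trans (m≡m%n+[m/n]*n m (suc e)) (cong (_+ (m / suc e) * suc e) eq)))
          (dil-nonmultiple A e (m / suc e) r (≤-pred (subst (_< suc e) eq (m%n<n m (suc e)))))

dil-⊛ : ∀ A B e → (dil A e ⊛ dil B e) ≐ dil (A ⊛ B) e
dil-⊛ A B e m = below m A m ≤-refl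
  where
  open ≡-Reasoning
  below : ∀ m A i → i ≤ m → (dil A e ⊛ dil B e) i ≡ dil (A ⊛ B) e i
  below zero    A .zero z≤n = refl
  below (suc m) A i i≤ with m≤n⇒m<n∨m≡n i≤
  ... | inj₁ i<   = below m A i (≤-pred i<)
  ... | inj₂ refl = begin
      (dil A e ⊛ dil B e) (suc m)
        ≡⟨ Σ≤-suc m _ ⟩
      A 0 * dil B e (suc m) + ((dil A e ∘ suc) ⊛ dil B e) m
        ≡⟨ cong₂ _+_ (cong (A 0 *_) (dil-suc B e m))
                     (trans (⊛-cong {G = dil B e} (dil-suc A e) ≐-refl m) (⊛-shiftˡ e (dil (A ∘ suc) e) (dil B e) m)) ⟩
      A 0 * shift e (dil (B ∘ suc) e) m + shift e (dil (A ∘ suc) e ⊛ dil B e) m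
        ≡⟨ cong₂ _+_ (sym (shift-scale e (A 0) _ m))
                     (shift-local e m (λ j eq → below m (A ∘ suc) j (subst (j ≤_) eq (m≤m+n j e)))) ⟩
      shift e (scale (A 0) (dil (B ∘ suc) e)) m + shift e (dil ((A ∘ suc) ⊛ B) e) m
        ≡⟨ sym (shift-⊕ e _ _ m) ⟩
      shift e (scale (A 0) (dil (B ∘ suc) e) ⊕ dil ((A ∘ suc) ⊛ B) e) m
        ≡⟨ shift-cong e (≐-sym (≐-trans (dilFrom-⊕ _ _ e 0) (⊕-cong (dilFrom-scale (A 0) (B ∘ suc) e 0) ≐-refl))) m ⟩
      shift e (dil (scale (A 0) (B ∘ suc) ⊕ ((A ∘ suc) ⊛ B)) e) m
        ≡⟨ shift-cong e (dil-cong e (≐-sym (⊛-suc A B))) m ⟩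
      shift e (dil ((A ⊛ B) ∘ suc) e) m
        ≡⟨ sym (dil-suc (A ⊛ B) e m) ⟩
      dil (A ⊛ B) e (suc m) ∎

dil-unique : ∀ e (Φ : Series → Series) →
  (∀ T → Φ T ≐ (scale (T 0) 𝟙 ⊕ shift (suc e) (Φ (T ∘ suc)))) → ∀ T → dil T e ≐ Φ T
dil-unique e Φ rec T m = below m T m ≤-refl
  where
  below : ∀ m T i → i ≤ m → dil T e i ≡ Φ T i
  below zero    T .zero z≤n = trans (dil-rec T e 0) (sym (rec T 0))
  below (suc m) T i i≤ with m≤n⇒m<n∨m≡n i≤
  ... | inj₁ i<   = below m T i (≤-pred i<)
  ... | inj₂ refl = trans (dil-rec T e (suc m)) (trans (cong (T 0 * 0 +_)
      (shift-local e m (λ j eq → below m (T ∘ suc) j (subst (j ≤_) eq (m≤m+n j e))))) (sym (rec T (suc m))))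

section : Series → ℕ → ℕ → Series
section T f u n = T (u + n * f)

sectionSum : ℕ → ℕ → Series → Series
sectionSum e f T = sumS (suc f) (λ u → shift (u * suc e) (dil (section T (suc f) u) (e + f * suc e)))

sectionSum-rec : ∀ e f T → sectionSum e f T ≐ (scale (T 0) 𝟙 ⊕ shift (suc e) (sectionSum e f (T ∘ suc)))
sectionSum-rec e f T =
  ≐-trans first (≐-trans (⊕-assoc-swap (scale (T 0) 𝟙) (shift (suc step) Y) (shift (suc e) rest))
                         (⊕-cong ≐-refl (≐-sym shifted)))
  where
  step = e + f * suc e
  Y = dil (section T (suc f) 0 ∘ suc) step
  rest = sumS f (λ u → shift (u * suc e) (dil (section (T ∘ suc) (suc f) u) step))
  ⊕-assoc-swap : ∀ A B C → ((A ⊕ B) ⊕ C) ≐ (A ⊕ (C ⊕ B))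
  ⊕-assoc-swap A B C n = trans (+-assoc (A n) (B n) (C n)) (cong (A n +_) (+-comm (B n) (C n)))
  -- split off section 0 and its constant term; the other sections of T are
  -- the sections 0 … f-1 of T ∘ suc, shifted by x^(e+1)
  first : sectionSum e f T ≐ ((scale (T 0) 𝟙 ⊕ shift (suc step) Y) ⊕ shift (suc e) rest)
  first = ⊕-cong (dil-rec (section T (suc f) 0) step)
                 (≐-trans (sumS-cong f (λ u → shift-+ (suc e) (u * suc e) _)) (≐-sym (shift-sumS (suc e) f _)))
  -- the last section of T ∘ suc is the tail of section 0 of T
  shifted : shift (suc e) (sectionSum e f (T ∘ suc)) ≐ (shift (suc e) rest ⊕ shift (suc step) Y)
  shifted = ≐-trans (shift-cong (suc e) (sumS-last f _))
              (≐-trans (shift-⊕ (suc e) _ _) (⊕-cong ≐-refl (≐-sym (shift-+ (suc e) (f * suc e) _))))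

dil-sections : ∀ e f T → dil T e ≐ sectionSum e f T
dil-sections e f = dil-unique e (sectionSum e f) (sectionSum-rec e f)

-- The ratio condition RT

EventuallyPositive : Series → Set
EventuallyPositive T = ∃ λ N → ∀ n → N ≤ n → 0 < T n

RatioBound : Series → ℕ → ℕ → Set
RatioBound T k M = ∀ m → M ≤ m → (k * T (suc m) ≤ suc k * T m) × (k * T m ≤ suc k * T (suc m))

RatiosTo1 : Series → Set
RatiosTo1 T = ∀ k → ∃ (RatioBound T k)

RT : Series → Set
RT T = EventuallyPositive T × RatiosTo1 T

RatioBound-mono : ∀ {T k M M'} → M ≤ M' → RatioBound T k M → RatioBound T k M'
RatioBound-mono le b m M'≤m = b m (≤-trans le M'≤m)

ratio-compose : ∀ K a b c → K * b ≤ suc K * a → K * c ≤ suc K * b → K * K * c ≤ suc K * suc K * a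
ratio-compose K a b c h₁ h₂ = begin
    K * K * c           ≡⟨ *-assoc K K c ⟩
    K * (K * c)         ≤⟨ *-monoʳ-≤ K h₂ ⟩
    K * (suc K * b)     ≡⟨ solve 3 (λ x y z → x :* (y :* z) := y :* (x :* z)) refl K (suc K) b ⟩
    suc K * (K * b)     ≤⟨ *-monoʳ-≤ (suc K) h₁ ⟩
    suc K * (suc K * a) ≡⟨ sym (*-assoc (suc K) (suc K) a) ⟩
    suc K * suc K * a   ∎
  where open ≤-Reasoning

-- With K = 2k+1 one has ((K+1)/K)² ≤ (k+1)/k, so a bound by ((K+1)/K)²
-- implies the bound by (k+1)/k.
ratio-weaken : ∀ k X Y → let K = k + suc k in K * K * X ≤ suc K * suc K * Y → k * X ≤ suc k * Y
ratio-weaken k X Y h = *-cancelʳ-≤ (k * X) (suc k * Y) (K * K) {{K*K≢0}} (begin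
    k * X * (K * K)           ≡⟨ solve 3 (λ k x y → k :* x :* y := k :* (y :* x)) refl k X (K * K) ⟩
    k * (K * K * X)           ≤⟨ *-monoʳ-≤ k h ⟩
    k * (suc K * suc K * Y)   ≤⟨ m≤m+n _ (suc k * Y) ⟩
    k * (suc K * suc K * Y) + suc k * Y
      ≡⟨ solve 2 (λ k y → k :* ((con 1 :+ (k :+ (con 1 :+ k))) :* (con 1 :+ (k :+ (con 1 :+ k))) :* y) :+ (con 1 :+ k) :* y
                         := (con 1 :+ k) :* y :* ((k :+ (con 1 :+ k)) :* (k :+ (con 1 :+ k)))) refl k Y ⟩
    suc k * Y * (K * K)       ∎)
  where
  open ≤-Reasoning
  K = k + suc k
  K*K≢0 : NonZero (K * K)
  K*K≢0 = subst (λ z → NonZero (z * z)) (sym (+-suc k k)) _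

ratio-iterate : ∀ {T} → RatiosTo1 T → ∀ j k → ∃ λ M → ∀ m → M ≤ m →
  (k * T (j + m) ≤ suc k * T m) × (k * T m ≤ suc k * T (j + m))
ratio-iterate r zero    k = 0 , λ m _ → m≤n+m _ _ , m≤n+m _ _
ratio-iterate {T} r (suc j) k = M₁ + M₂ , λ m M≤m →
    let a = proj₂ (ratio-iterate r j K) m (≤-trans (m≤m+n M₁ M₂) M≤m)
        b = proj₂ (r K) (j + m) (≤-trans (≤-trans (m≤n+m M₂ M₁) M≤m) (m≤n+m m j))
    in ratio-weaken k _ _ (ratio-compose K (T m) (T (j + m)) (T (suc (j + m))) (proj₁ a) (proj₁ b))
     , ratio-weaken k _ _ (ratio-compose K (T (suc (j + m))) (T (j + m)) (T m) (proj₂ b) (proj₂ a))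
  where
  K = k + suc k
  M₁ = proj₁ (ratio-iterate r j K)
  M₂ = proj₁ (r K)

-- Residue sections of an RT sequence are RT: its ratios are ratios of T
-- over f+1 consecutive steps.
RT-section : ∀ T f u → RT T → RT (section T (suc f) u)
RT-section T f u ((N , pos) , rat) = (N , λ n N≤n → pos (u + n * suc f) (≤-trans N≤n (n≤index n))) , rat'
  where
  n≤index : ∀ n → n ≤ u + n * suc f
  n≤index n = ≤-trans (m≤m*n n (suc f)) (m≤n+m _ u)
  index : ∀ n → u + suc n * suc f ≡ suc f + (u + n * suc f)
  index n = solve 3 (λ u n f → u :+ (con 1 :+ n) :* (con 1 :+ f) := (con 1 :+ f) :+ (u :+ n :* (con 1 :+ f))) refl u n f
  rat' : RatiosTo1 (section T (suc f) u)
  rat' k = proj₁ (ratio-iterate rat (suc f) k) , λ n M≤n →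
    let h = proj₂ (ratio-iterate rat (suc f) k) (u + n * suc f) (≤-trans M≤n (n≤index n))
    in subst (λ z → k * T z ≤ suc k * T (u + n * suc f)) (sym (index n)) (proj₁ h)
     , subst (λ z → k * T (u + n * suc f) ≤ suc k * T z) (sym (index n)) (proj₂ h)

-- Cauchy products of RT sequences

m+n≤o⇒n≤o∸m : ∀ m n o → m + n ≤ o → n ≤ o ∸ m
m+n≤o⇒n≤o∸m m n o h = subst (_≤ o ∸ m) (m+n∸m≡n m n) (∸-monoˡ-≤ m h)

-- Eventually positive sequences have an eventually positive product: from
-- NA + NB on, the term A_NA · B_(n-NA) is positive.
⊛-positive : ∀ {A B} → EventuallyPositive A → EventuallyPositive B → EventuallyPositive (A ⊛ B)
⊛-positive {A} {B} (NA , posA) (NB , posB) = NA + NB , λ n le →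
  <-≤-trans (positive-product (posA NA ≤-refl) (posB (n ∸ NA) (m+n≤o⇒n≤o∸m NA NB n le)))
            (Σ≤-term n (λ i → A i * B (n ∸ i)) NA (≤-trans (m≤m+n NA NB) le))
  where
  positive-product : ∀ {a b} → 0 < a → 0 < b → 0 < a * b
  positive-product {suc a} {suc b} _ _ = s≤s z≤n

Σ≤-scaled-mono : ∀ n K L (f g : ℕ → ℕ) → (∀ i → i ≤ n → K * f i ≤ L * g i) → K * Σ≤ n f ≤ L * Σ≤ n g
Σ≤-scaled-mono n K L f g h = begin
    K * Σ≤ n f           ≡⟨ sym (Σ≤-* n K f) ⟩
    Σ≤ n (λ i → K * f i) ≤⟨ Σ≤-mono n h ⟩
    Σ≤ n (λ i → L * g i) ≡⟨ Σ≤-* n L g ⟩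
    L * Σ≤ n g           ∎
  where open ≤-Reasoning

scaled-*ˡ : ∀ K L a b b' → K * b' ≤ L * b → K * (a * b') ≤ L * (a * b)
scaled-*ˡ K L a b b' h = begin
    K * (a * b') ≡⟨ solve 3 (λ x y z → x :* (y :* z) := y :* (x :* z)) refl K a b' ⟩
    a * (K * b') ≤⟨ *-monoʳ-≤ a h ⟩
    a * (L * b)  ≡⟨ solve 3 (λ x y z → x :* (y :* z) := y :* (x :* z)) refl a L b ⟩
    L * (a * b)  ∎
  where open ≤-Reasoning

scaled-*ʳ : ∀ K L a a' b → K * a' ≤ L * a → K * (a' * b) ≤ L * (a * b)
scaled-*ʳ K L a a' b h = begin
    K * (a' * b) ≡⟨ sym (*-assoc K a' b) ⟩
    K * a' * b   ≤⟨ *-monoˡ-≤ b h ⟩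
    L * a * b    ≡⟨ *-assoc L a b ⟩
    L * (a * b)  ∎
  where open ≤-Reasoning

-- Lower bound for the ratio of A·B at n = p + q' + 1: if A grows at rate at
-- least k/(k+1) from p on and B from q'+1 on, so does A·B, comparing the
-- terms A_i B_(n-i) with A_i B_(n+1-i) (i ≤ p) and with A_(i+1) B_(n-i) (i > p).
⊛-lower-step : ∀ (A B : Series) k p q' →
  (∀ i → p ≤ i → k * A i ≤ suc k * A (suc i)) →
  (∀ x → suc q' ≤ x → k * B x ≤ suc k * B (suc x)) →
  k * (A ⊛ B) (p + suc q') ≤ suc k * (A ⊛ B) (suc (p + suc q'))
⊛-lower-step A B k p q' hA hB = begin
    k * Σ≤ n s                                  ≡⟨ cong (k *_) (Σ≤-split p q' s) ⟩
    k * (Σ≤ p s + Σ≤ q' (λ j → s (p + suc j)))   ≡⟨ *-distribˡ-+ k _ _ ⟩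
    k * Σ≤ p s + k * Σ≤ q' (λ j → s (p + suc j))
      ≤⟨ +-mono-≤ (Σ≤-scaled-mono p k (suc k) s t head) (Σ≤-scaled-mono q' k (suc k) _ _ tail) ⟩
    suc k * Σ≤ p t + suc k * Σ≤ q' (λ j → t (p + suc (suc j)))
      ≡⟨ sym (*-distribˡ-+ (suc k) (Σ≤ p t) _) ⟩
    suc k * (Σ≤ p t + Σ≤ q' (λ j → t (p + suc (suc j))))
      ≤⟨ *-monoʳ-≤ (suc k) (+-monoʳ-≤ (Σ≤ p t) (≤-trans (m≤n+m _ _) (≤-reflexive (sym (Σ≤-suc q' (λ j → t (p + suc j))))))) ⟩
    suc k * (Σ≤ p t + Σ≤ (suc q') (λ j → t (p + suc j))) ≡⟨ cong (suc k *_) (sym (Σ≤-split p (suc q') t)) ⟩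
    suc k * Σ≤ (p + suc (suc q')) t                     ≡⟨ cong (λ z → suc k * Σ≤ z t) (+-suc p (suc q')) ⟩
    suc k * Σ≤ (suc n) t ∎
  where
  open ≤-Reasoning
  n = p + suc q'
  s = λ i → A i * B (n ∸ i)
  t = λ i → A i * B (suc n ∸ i)
  head : ∀ i → i ≤ p → k * s i ≤ suc k * t i
  head i i≤p = scaled-*ˡ k (suc k) (A i) _ _
    (subst (λ z → k * B (n ∸ i) ≤ suc k * B z) (sym (∸-suc (≤-trans i≤p (m≤m+n p _))))
      (hB (n ∸ i) (subst (_≤ n ∸ i) (m+n∸m≡n p (suc q')) (∸-monoʳ-≤ n i≤p))))
  tail : ∀ j → j ≤ q' → k * s (p + suc j) ≤ suc k * t (p + suc (suc j))
  tail j _ rewrite +-suc p (suc j) = scaled-*ʳ k (suc k) _ _ _ (hA (p + suc j) (m≤m+n p _))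

-- Upper bound for the ratio of A·B at n = p + q, up to the single extra
-- term A_p B_q: compare A_i B_(n+1-i) with A_i B_(n-i) (i ≤ p) and
-- A_(i+1) B_(n-i) with A_i B_(n-i) (i ≥ p).
⊛-upper-step : ∀ (A B : Series) K p q →
  (∀ i → p ≤ i → K * A (suc i) ≤ suc K * A i) →
  (∀ x → q ≤ x → K * B (suc x) ≤ suc K * B x) →
  K * (A ⊛ B) (suc (p + q)) ≤ suc K * ((A ⊛ B) (p + q) + A p * B q)
⊛-upper-step A B K p q hA hB = begin
    K * Σ≤ (suc n) t                             ≡⟨ cong (λ z → K * Σ≤ z t) (sym (+-suc p q)) ⟩
    K * Σ≤ (p + suc q) t                         ≡⟨ cong (K *_) (Σ≤-split p q t) ⟩
    K * (Σ≤ p t + Σ≤ q (λ j → t (p + suc j)))    ≡⟨ *-distribˡ-+ K _ _ ⟩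
    K * Σ≤ p t + K * Σ≤ q (λ j → t (p + suc j))
      ≤⟨ +-mono-≤ (Σ≤-scaled-mono p K (suc K) t s head) (Σ≤-scaled-mono q K (suc K) _ _ tail) ⟩
    suc K * Σ≤ p s + suc K * Σ≤ q (λ j → s (p + j)) ≡⟨ sym (*-distribˡ-+ (suc K) (Σ≤ p s) _) ⟩
    suc K * (Σ≤ p s + Σ≤ q (λ j → s (p + j)))       ≡⟨ cong (suc K *_) (Σ≤-split-overlap p q s) ⟩
    suc K * (Σ≤ n s + s p)                          ≡⟨ cong (λ z → suc K * (Σ≤ n s + A p * B z)) (m+n∸m≡n p q) ⟩
    suc K * (Σ≤ n s + A p * B q) ∎
  where
  open ≤-Reasoning
  n = p + q
  s = λ i → A i * B (n ∸ i)
  t = λ i → A i * B (suc n ∸ i)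
  head : ∀ i → i ≤ p → K * t i ≤ suc K * s i
  head i i≤p = scaled-*ˡ K (suc K) (A i) _ _
    (subst (λ z → K * B z ≤ suc K * B (n ∸ i)) (sym (∸-suc (≤-trans i≤p (m≤m+n p _))))
      (hB (n ∸ i) (subst (_≤ n ∸ i) (m+n∸m≡n p q) (∸-monoʳ-≤ n i≤p))))
  tail : ∀ j → j ≤ q → K * t (p + suc j) ≤ suc K * s (p + j)
  tail j _ rewrite +-suc p j = scaled-*ʳ K (suc K) _ _ _ (hA (p + j) (m≤m+n p _))

Σ≤-small-term : ∀ R (f : ℕ → ℕ) → ∃ λ r → r ≤ R × suc R * f r ≤ Σ≤ R f
Σ≤-small-term zero    f = 0 , z≤n , ≤-reflexive (+-identityʳ (f 0))
Σ≤-small-term (suc R) f with Σ≤-small-term R f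
... | r , r≤R , h with f (suc R) ≤? f r
...   | yes le = suc R , ≤-refl , ≤-trans (≤-reflexive (+-comm (f (suc R)) _))
                   (+-monoˡ-≤ (f (suc R)) (≤-trans (*-monoʳ-≤ (suc R) le) h))
...   | no nle = r , m≤n⇒m≤1+n r≤R , ≤-trans (≤-reflexive (+-comm (f r) _)) (+-mono-≤ h (<⇒≤ (≰⇒> nle)))

-- The extra term of ⊛-upper-step is absorbed when it is at most a
-- 1/(K+1)-fraction of the current coefficient.
ratio-absorb : ∀ K c c' s → K * c' ≤ suc K * (c + s) → suc K * s ≤ c → K * K * c' ≤ suc K * suc K * c
ratio-absorb K c c' s U V = begin
    K * K * c'                ≡⟨ *-assoc K K c' ⟩
    K * (K * c')              ≤⟨ *-monoʳ-≤ K U ⟩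
    K * (suc K * (c + s))     ≡⟨ solve 4 (λ K K' c s → K :* (K' :* (c :+ s)) := K' :* (K :* c :+ K :* s)) refl K (suc K) c s ⟩
    suc K * (K * c + K * s)   ≤⟨ *-monoʳ-≤ (suc K) (+-monoʳ-≤ (K * c) (≤-trans (m≤n+m (K * s) s) V)) ⟩
    suc K * (K * c + c)       ≡⟨ solve 2 (λ K c → (con 1 :+ K) :* (K :* c :+ c) := (con 1 :+ K) :* (con 1 :+ K) :* c) refl K c ⟩
    suc K * suc K * c         ∎
  where open ≤-Reasoning

⊛-ratio-lower : ∀ {A B k M} → RatioBound A k M → RatioBound B k M →
  ∀ n → suc (M + M) ≤ n → k * (A ⊛ B) n ≤ suc k * (A ⊛ B) (suc n)
⊛-ratio-lower {A} {B} {k} {M} bA bB n le =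
  subst (λ z → k * (A ⊛ B) z ≤ suc k * (A ⊛ B) (suc z)) n≡ (⊛-lower-step A B k M q' hA hB)
  where
  q' = n ∸ suc M
  n≡ : M + suc q' ≡ n
  n≡ = trans (+-suc M q') (m+[n∸m]≡n (≤-trans (s≤s (m≤m+n M M)) le))
  M≤q' : M ≤ q'
  M≤q' = m+n≤o⇒n≤o∸m (suc M) M n le
  hA : ∀ i → M ≤ i → k * A i ≤ suc k * A (suc i)
  hA i M≤i = proj₂ (bA i M≤i)
  hB : ∀ x → suc q' ≤ x → k * B x ≤ suc k * B (suc x)
  hB x le' = proj₂ (bB x (≤-trans M≤q' (≤-trans (n≤1+n q') le')))

-- Bounds for K = 2k+1
-- are needed, and the extra term of ⊛-upper-step is taken at the smallest
-- of K+1 consecutive terms A_p B_(n-p), p = M, …, M+K.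
⊛-ratio-upper : ∀ {A B k M} → let K = k + suc k in RatioBound A K M → RatioBound B K M →
  ∀ n → suc (M + M + K) ≤ n → k * (A ⊛ B) (suc n) ≤ suc k * (A ⊛ B) n
⊛-ratio-upper {A} {B} {k} {M} bA bB n le with Σ≤-small-term (k + suc k) (λ r → A (M + r) * B (n ∸ (M + r)))
... | r , r≤K , small = ratio-weaken k _ _ (ratio-absorb K ((A ⊛ B) n) ((A ⊛ B) (suc n)) (A p * B q) upper extra)
  where
  K = k + suc k
  s = λ i → A i * B (n ∸ i)
  p = M + r
  q = n ∸ p
  M+K≤n : M + K ≤ n
  M+K≤n = ≤-trans (≤-trans (m≤n+m (M + K) M) (≤-reflexive (sym (+-assoc M M K)))) (≤-trans (n≤1+n _) le)
  p+M≤n : p + M ≤ n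
  p+M≤n = ≤-trans (+-monoˡ-≤ M (+-monoʳ-≤ M r≤K))
            (≤-trans (≤-reflexive (solve 2 (λ M K → M :+ K :+ M := M :+ M :+ K) refl M K)) (≤-trans (n≤1+n _) le))
  hA : ∀ i → p ≤ i → K * A (suc i) ≤ suc K * A i
  hA i p≤i = proj₁ (bA i (≤-trans (m≤m+n M r) p≤i))
  hB : ∀ x → q ≤ x → K * B (suc x) ≤ suc K * B x
  hB x q≤x = proj₁ (bB x (≤-trans (m+n≤o⇒n≤o∸m p M n p+M≤n) q≤x))
  upper : K * (A ⊛ B) (suc n) ≤ suc K * ((A ⊛ B) n + A p * B q)
  upper = subst (λ z → K * (A ⊛ B) (suc z) ≤ suc K * ((A ⊛ B) z + A p * B q))
                (m+[n∸m]≡n (≤-trans (m≤m+n p M) p+M≤n)) (⊛-upper-step A B K p q hA hB)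
  extra : suc K * (A p * B q) ≤ (A ⊛ B) n
  extra = ≤-trans small (≤-trans (Σ≤-window M K s)
            (subst (λ z → Σ≤ (M + K) s ≤ Σ≤ z s) (m+[n∸m]≡n M+K≤n) (Σ≤-extend (M + K) (n ∸ (M + K)) s)))

common-bound : ∀ {A B} → RatiosTo1 A → RatiosTo1 B → ∀ k → ∃ λ M → RatioBound A k M × RatioBound B k M
common-bound {A} {B} rA rB k with rA k | rB k
... | MA , bA | MB , bB = MA ⊔ MB , RatioBound-mono {A} {k} (m≤m⊔n MA MB) bA , RatioBound-mono {B} {k} (m≤n⊔m MA MB) bB

RT-⊛ : ∀ {A B} → RT A → RT B → RT (A ⊛ B)
RT-⊛ {A} {B} (pA , rA) (pB , rB) = ⊛-positive pA pB , ratios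
  where
  ratios : RatiosTo1 (A ⊛ B)
  ratios k with common-bound rA rB k | common-bound rA rB (k + suc k)
  ... | M , bA , bB | M' , bA' , bB' = N₁ ⊔ N₂ , λ n le →
      ⊛-ratio-upper {A} {B} {k} bA' bB' n (≤-trans (m≤n⊔m N₁ N₂) le) ,
      ⊛-ratio-lower {A} {B} {k} bA bB n (≤-trans (m≤m⊔n N₁ N₂) le)
    where
    N₁ = suc (M + M)
    N₂ = suc (M' + M' + (k + suc k))

-- RT is equivalent to RTN₁

-- For b = b'+1, the numerator of a/b - 1 as it arises in ℚᵘ arithmetic; it
-- is a - b.
gap : ℕ → ℕ → ℤ
gap a b' = (ℤ.+ a) ℤ.* (ℤ.+ 1) ℤ.+ -[1+ 0 ] ℤ.* (ℤ.+ suc b')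

gap≡ : ∀ a b' → gap a b' ≡ a ⊖ suc b'
gap≡ a b' = cong₂ ℤ._+_ (ℤP.*-identityʳ (ℤ.+ a)) (cong -[1+_] (+-identityʳ b'))

∣gap∣-≤ : ∀ a b' → a ≤ suc b' → ℤ.∣ gap a b' ∣ ≡ suc b' ∸ a
∣gap∣-≤ a b' le = trans (cong ℤ.∣_∣ (gap≡ a b')) (ℤP.∣⊖∣-≤ le)

∣gap∣-≥ : ∀ a b' → suc b' ≤ a → ℤ.∣ gap a b' ∣ ≡ a ∸ suc b'
∣gap∣-≥ a b' le = trans (cong ℤ.∣_∣ (gap≡ a b')) (cong ℤ.∣_∣ (ℤP.⊖-≥ le))

distᵘ : ℕ → ℕ → ℚᵘ
distᵘ a b' = ℚᵘ.∣ mkℚᵘ (ℤ.+ a) b' ℚᵘ.- mkℚᵘ (ℤ.+ 1) 0 ∣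

dist : (a b : ℕ) → .{{NonZero b}} → ℚ
dist a b = ℚ.∣ (ℤ.+ a) ℚ./ b ℚ.- 1ℚ ∣

dist≃distᵘ : ∀ a b' → toℚᵘ (dist a (suc b')) ℚᵘ.≃ distᵘ a b'
dist≃distᵘ a b' = ℚᵘP.≃-trans (ℚP.toℚᵘ-homo-∣-∣ ((ℤ.+ a) ℚ./ suc b' ℚ.- 1ℚ)) (ℚᵘP.∣-∣-cong
  (ℚᵘP.≃-trans (ℚP.toℚᵘ-homo-+ ((ℤ.+ a) ℚ./ suc b') (ℚ.- 1ℚ)) (ℚᵘP.+-cong (ℚP.toℚᵘ-fromℚᵘ (mkℚᵘ (ℤ.+ a) b'))
     (ℚᵘP.≃-trans (ℚP.toℚᵘ-homo‿- 1ℚ) (ℚᵘP.-‿cong (ℚP.toℚᵘ-fromℚᵘ (mkℚᵘ (ℤ.+ 1) 0)))))))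

1/suc≃ : ∀ c' → toℚᵘ (ℤ.+ 1 ℚ./ suc c') ℚᵘ.≃ mkℚᵘ (ℤ.+ 1) c'
1/suc≃ c' = ℚP.toℚᵘ-fromℚᵘ (mkℚᵘ (ℤ.+ 1) c')

dist<⇒ : ∀ a b' c' → dist a (suc b') ℚ.< (ℤ.+ 1 ℚ./ suc c') → ℤ.∣ gap a b' ∣ * suc c' < suc b'
dist<⇒ a b' c' h with ℚᵘP.<-respʳ-≃ (1/suc≃ c') (ℚᵘP.<-respˡ-≃ (dist≃distᵘ a b') (ℚP.toℚᵘ-mono-< h))
... | ℚᵘ.*<* p = ℤP.drop‿+<+ (subst₂ ℤ._<_ (sym (ℤP.pos-* (ℤ.∣ gap a b' ∣) (suc c')))
   (trans (ℤP.*-identityˡ (ℤ.+ (suc b' * 1))) (cong ℤ.+_ (*-identityʳ (suc b')))) p)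

dist<⇐ : ∀ a b' c' → ℤ.∣ gap a b' ∣ * suc c' < suc b' → dist a (suc b') ℚ.< (ℤ.+ 1 ℚ./ suc c')
dist<⇐ a b' c' h = ℚP.toℚᵘ-cancel-< (ℚᵘP.<-respʳ-≃ (ℚᵘP.≃-sym (1/suc≃ c')) (ℚᵘP.<-respˡ-≃ (ℚᵘP.≃-sym (dist≃distᵘ a b'))
  (ℚᵘ.*<* (subst₂ ℤ._<_ (ℤP.pos-* (ℤ.∣ gap a b' ∣) (suc c'))
     (sym (trans (ℤP.*-identityˡ (ℤ.+ (suc b' * 1))) (cong ℤ.+_ (*-identityʳ (suc b'))))) (ℤ.+<+ h)))))

compare-by-difference : ∀ a b → (∃ λ d → b ≡ a + d × a ≤ b) ⊎ (∃ λ d → a ≡ b + d × b < a)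
compare-by-difference a b with ≤-<-connex a b
... | inj₁ a≤b = inj₁ (b ∸ a , sym (m+[n∸m]≡n a≤b) , a≤b)
... | inj₂ b<a = inj₂ (a ∸ b , sym (m+[n∸m]≡n (<⇒≤ b<a)) , b<a)

small-gap⇒ratio : ∀ a b' c → ℤ.∣ gap a b' ∣ * c < suc b' → (c * a < suc c * suc b') × (c * suc b' < suc b' + c * a)
small-gap⇒ratio a b' c h with compare-by-difference a (suc b')
... | inj₁ (d , eq , le) rewrite ∣gap∣-≤ a b' le =
  ≤-<-trans (*-monoʳ-≤ c le) (m<n+m (c * suc b') (s≤s z≤n)) ,
  ≤-<-trans (≤-reflexive (trans (cong (c *_) eq) (solve 3 (λ c a d → c :* (a :+ d) := c :* a :+ d :* c) refl c a d)))
    (<-≤-trans (+-monoʳ-< (c * a) dc<) (≤-reflexive (+-comm (c * a) (suc b'))))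
  where
  dc< : d * c < suc b'
  dc< = subst (λ z → z * c < suc b') (trans (cong (_∸ a) eq) (m+n∸m≡n a d)) h
... | inj₂ (d , eq , lt) rewrite ∣gap∣-≥ a b' (<⇒≤ lt) =
  subst (λ z → c * z < suc c * suc b') (sym eq)
    (≤-<-trans (≤-reflexive (solve 3 (λ c b d → c :* (b :+ d) := c :* b :+ d :* c) refl c (suc b') d))
      (<-≤-trans (+-monoʳ-< (c * suc b') dc<) (≤-reflexive (+-comm (c * suc b') (suc b'))))) ,
  ≤-<-trans (*-monoʳ-≤ c (<⇒≤ lt)) (m<n+m (c * a) (s≤s z≤n))
  where
  dc< : d * c < suc b'
  dc< = subst (λ z → z * c < suc b') (trans (cong (_∸ suc b') eq) (m+n∸m≡n (suc b') d)) h

double≤⇒< : ∀ x b → x + x ≤ b → 0 < b → x < b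
double≤⇒< zero    b _  p = p
double≤⇒< (suc x) b le _ = ≤-trans (s≤s (m≤n+m (suc x) x)) le

ratio⇒small-gap : ∀ a b' c → (c + c) * suc b' ≤ suc (c + c) * a → (c + c) * a ≤ suc (c + c) * suc b' →
  ℤ.∣ gap a b' ∣ * c < suc b'
ratio⇒small-gap a b' c h₁ h₂ with compare-by-difference a (suc b')
... | inj₁ (d , eq , le) rewrite ∣gap∣-≤ a b' le | eq | m+n∸m≡n a d =
  subst (_< a + d) (*-comm c d) (double≤⇒< (c * d) (a + d) (≤-trans twice≤ (m≤m+n a d)) (subst (0 <_) eq (s≤s z≤n)))
  where
  twice≤ : c * d + c * d ≤ a
  twice≤ = +-cancelˡ-≤ ((c + c) * a) _ _
    (≤-trans (≤-reflexive (solve 3 (λ c a d → (c :+ c) :* a :+ (c :* d :+ c :* d) := (c :+ c) :* (a :+ d)) refl c a d))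
             (≤-trans h₁ (≤-reflexive (+-comm a _))))
... | inj₂ (d , eq , lt) rewrite ∣gap∣-≥ a b' (<⇒≤ lt) | eq | m+n∸m≡n (suc b') d =
  subst (_< suc b') (*-comm c d) (double≤⇒< (c * d) (suc b') twice≤ (s≤s z≤n))
  where
  twice≤ : c * d + c * d ≤ suc b'
  twice≤ = +-cancelˡ-≤ ((c + c) * suc b') _ _
    (≤-trans (≤-reflexive (solve 3 (λ c b d → (c :+ c) :* b :+ (c :* d :+ c :* d) := (c :+ c) :* (b :+ d)) refl c (suc b') d))
             (≤-trans h₂ (≤-reflexive (+-comm (suc b') _))))

close⇒ratio : ∀ a b c' → 0 < b → ((nz : NonZero b) → ℚ.∣ ((ℤ.+ a) ℚ./ b) {{nz}} ℚ.- 1ℚ ∣ ℚ.< (ℤ.+ 1 ℚ./ suc c')) →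
  (suc c' * a < suc (suc c') * b) × (suc c' * b < b + suc c' * a)
close⇒ratio a (suc b') c' _ h = small-gap⇒ratio a b' (suc c') (dist<⇒ a b' c' (h _))

ratio⇒close : ∀ a b c' (nz : NonZero b) → let C = suc c' + suc c' in C * b ≤ suc C * a → C * a ≤ suc C * b →
  ℚ.∣ ((ℤ.+ a) ℚ./ b) {{nz}} ℚ.- 1ℚ ∣ ℚ.< (ℤ.+ 1 ℚ./ suc c')
ratio⇒close a (suc b') c' nz h₁ h₂ = dist<⇐ a b' c' (ratio⇒small-gap a b' (suc c') h₁ h₂)

1/suc-positive : ∀ c' → 0ℚ ℚ.< (ℤ.+ 1 ℚ./ suc c')
1/suc-positive c' = ℚP.positive⁻¹ (ℤ.+ 1 ℚ./ suc c') {{ℚP.normalize-pos 1 (suc c')}}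

1/suc≤ : ∀ n d .(c : Coprime (suc n) (suc d)) → (ℤ.+ 1 ℚ./ suc d) ℚ.≤ mkℚ (ℤ.+ suc n) d c
1/suc≤ n d c = ℚP.toℚᵘ-cancel-≤ (ℚᵘP.≤-respˡ-≃ (ℚᵘP.≃-sym (1/suc≃ d))
  (ℚᵘ.*≤* (subst₂ ℤ._≤_ (ℤP.pos-* 1 (suc d)) (ℤP.pos-* (suc n) (suc d)) (ℤ.+≤+ (*-monoˡ-≤ (suc d) {1} {suc n} (s≤s z≤n))))))

-- The limit condition at tolerances 1/(k+1) and 1/(k+2) yields the ratio
-- bound for k+1.
RTN₁⇒RT : ∀ T → RTN₁ T → RT T
RTN₁⇒RT T ((N , pos) , close) = (N , pos) , ratios
  where
  ratios : RatiosTo1 T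
  ratios zero    = 0 , λ m _ → z≤n , z≤n
  ratios (suc k) = M₁ + M₂ + N , λ m le →
      let b>0 = pos (suc m) (≤-trans (m≤n+m N (M₁ + M₂)) (m≤n⇒m≤1+n le))
          at-k = close⇒ratio (T m) (T (suc m)) k b>0
                   (proj₂ (close _ (1/suc-positive k)) m (≤-trans (≤-trans (m≤m+n M₁ M₂) (m≤m+n (M₁ + M₂) N)) le))
          at-k+1 = close⇒ratio (T m) (T (suc m)) (suc k) b>0
                   (proj₂ (close _ (1/suc-positive (suc k))) m (≤-trans (≤-trans (m≤n+m M₂ M₁) (m≤m+n (M₁ + M₂) N)) le))
      in <⇒≤ (+-cancelˡ-< (T (suc m)) _ _
            (subst (_< T (suc m) + suc (suc k) * T m)
                   (solve 2 (λ b k → (con 2 :+ k) :* b := b :+ (con 1 :+ k) :* b) refl (T (suc m)) k) (proj₂ at-k+1)))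
       , <⇒≤ (proj₁ at-k)
    where
    M₁ = proj₁ (close _ (1/suc-positive k))
    M₂ = proj₁ (close _ (1/suc-positive (suc k)))

-- A positive tolerance n/(d+1) is met once the ratio bound for 2(d+1) holds.
RT⇒RTN₁ : ∀ T → RT T → RTN₁ T
RT⇒RTN₁ T (pos , ratios) = pos , close
  where
  close : ∀ (ε : ℚ) → 0ℚ ℚ.< ε → ∃ λ M → ∀ m → M ≤ m → (nz : NonZero (T (suc m))) →
    ℚ.∣ ((ℤ.+ T m) ℚ./ T (suc m)) {{nz}} ℚ.- 1ℚ ∣ ℚ.< ε
  close (mkℚ (ℤ.+ suc n) d c) _ = proj₁ (ratios (suc d + suc d)) , λ m le nz →
    let r = proj₂ (ratios (suc d + suc d)) m le
    in ℚP.<-≤-trans (ratio⇒close (T m) (T (suc m)) d nz (proj₁ r) (proj₂ r)) (1/suc≤ n d c)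
  close (mkℚ (ℤ.+ zero) d c) (ℚ.*<* (ℤ.+<+ ()))
  close (mkℚ -[1+ n ] d c)   (ℚ.*<* ())

-- The class 𝔖 as an inductively generated span

data Atom : Series → Set where
  monomial : ∀ j → Atom (shift j 𝟙)
  dilated  : ∀ j T e → RT T → Atom (shift j (dil T e))

data Span : Series → Set where
  span-𝟘    : Span 𝟘
  span-atom : ∀ {A} → Atom A → Span A
  span-⊕    : ∀ {P Q} → Span P → Span Q → Span (P ⊕ Q)
  span-≐    : ∀ {P Q} → P ≐ Q → Span P → Span Q

atom-x : ∀ {A} → Atom A → Atom (xTimes A)
atom-x (monomial j)    = monomial (suc j)
atom-x (dilated j T e r) = dilated (suc j) T e r

span-x : ∀ {P} → Span P → Span (xTimes P)
span-x span-𝟘         = span-≐ (≐-sym (shift-𝟘 1)) span-𝟘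
span-x (span-atom a)  = span-atom (atom-x a)
span-x (span-⊕ p q)   = span-≐ (≐-sym (shift-⊕ 1 _ _)) (span-⊕ (span-x p) (span-x q))
span-x (span-≐ e p)   = span-≐ (xTimes-cong e) (span-x p)

span-shift : ∀ j {P} → Span P → Span (shift j P)
span-shift zero    p = p
span-shift (suc j) p = span-x (span-shift j p)

span-scale : ∀ c {P} → Span P → Span (scale c P)
span-scale zero    p = span-≐ (λ n → refl) span-𝟘
span-scale (suc c) p = span-⊕ p (span-scale c p)

span-⊛-sumS : ∀ a b {F G} → (∀ u v → Span (F u ⊛ G v)) → Span (sumS a F ⊛ sumS b G)
span-⊛-sumS zero    b {F} {G} h = span-≐ (≐-sym (⊛-zeroˡ (sumS b G))) span-𝟘
span-⊛-sumS (suc a) b {F} {G} h =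
  span-≐ (≐-sym (⊛-distribʳ (sumS b G) (F 0) (sumS a (F ∘ suc))))
         (span-⊕ (right b {F 0} {G} (h 0)) (span-⊛-sumS a b {F ∘ suc} {G} (λ u v → h (suc u) v)))
  where
  right : ∀ b {X G} → (∀ v → Span (X ⊛ G v)) → Span (X ⊛ sumS b G)
  right zero    {X}     h = span-≐ (≐-sym (⊛-zeroʳ X)) span-𝟘
  right (suc b) {X} {G} h = span-≐ (≐-sym (⊛-distribˡ X (G 0) (sumS b (G ∘ suc))))
                                   (span-⊕ (h 0) (right b {X} {G ∘ suc} (λ v → h (suc v))))

-- Split T into its f+1
-- and S into its e+1 residue sections; all pieces are dilations with the
-- common step (e+1)(f+1), so each pairwise product is a single atom by
-- dil-⊛, and sections and products of RT sequences are RT.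
dilated-⊛ : ∀ T e S f → RT T → RT S → Span (dil T e ⊛ dil S f)
dilated-⊛ T e S f rT rS = span-≐ decomposition (span-⊛-sumS (suc f) (suc e) {F} {G} term)
  where
  D = e + f * suc e
  F : ℕ → Series
  F u = shift (u * suc e) (dil (section T (suc f) u) D)
  G : ℕ → Series
  G v = shift (v * suc f) (dil (section S (suc e) v) D)
  same-step : f + e * suc f ≡ D
  same-step = cong pred (*-comm (suc e) (suc f))
  term : ∀ u v → Span (F u ⊛ G v)
  term u v = span-≐
    (≐-sym (≐-trans (⊛-shift (u * suc e) (v * suc f) _ _)
                    (shift-cong (u * suc e) (shift-cong (v * suc f) (dil-⊛ (section T (suc f) u) (section S (suc e) v) D)))))
    (span-shift (u * suc e) (span-atom (dilated (v * suc f) _ D (RT-⊛ (RT-section T f u rT) (RT-section S e v rS)))))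
  decomposition : (sumS (suc f) F ⊛ sumS (suc e) G) ≐ (dil T e ⊛ dil S f)
  decomposition = ≐-sym (⊛-cong (dil-sections e f T)
    (≐-trans (dil-sections f e S) (sumS-cong (suc e) (λ v → shift-cong (v * suc f) (λ n → cong (λ z → dil (section S (suc e) v) z n) same-step)))))

atom-⊛ : ∀ {A B} → Atom A → Atom B → Span (A ⊛ B)
atom-⊛ (monomial j) (monomial l) =
  span-≐ (≐-sym (≐-trans (⊛-shift j l 𝟙 𝟙) (≐-trans (shift-cong j (shift-cong l (⊛-identityˡ 𝟙))) (≐-sym (shift-+ j l 𝟙)))))
         (span-atom (monomial (j + l)))
atom-⊛ (monomial j) (dilated l T e r) =
  span-≐ (≐-sym (≐-trans (⊛-shift j l 𝟙 _) (shift-cong j (shift-cong l (⊛-identityˡ _))))) (span-shift j (span-atom (dilated l T e r)))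
atom-⊛ (dilated j T e r) (monomial l) =
  span-≐ (≐-sym (≐-trans (⊛-shift j l _ 𝟙) (shift-cong j (shift-cong l (⊛-identityʳ _))))) (span-shift j (span-atom (dilated l T e r)))
atom-⊛ (dilated j T e r) (dilated l S f r') =
  span-≐ (≐-sym (⊛-shift j l _ _)) (span-shift j (span-shift l (dilated-⊛ T e S f r r')))

atom-⊛-span : ∀ {A Q} → Atom A → Span Q → Span (A ⊛ Q)
atom-⊛-span {A} a span-𝟘          = span-≐ (≐-sym (⊛-zeroʳ A)) span-𝟘
atom-⊛-span     a (span-atom b)   = atom-⊛ a b
atom-⊛-span {A} a (span-⊕ {P} {Q} p q) = span-≐ (≐-sym (⊛-distribˡ A P Q)) (span-⊕ (atom-⊛-span a p) (atom-⊛-span a q))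
atom-⊛-span {A} a (span-≐ e p)    = span-≐ (⊛-cong {A} {A} ≐-refl e) (atom-⊛-span a p)

span-⊛ : ∀ {P Q} → Span P → Span Q → Span (P ⊛ Q)
span-⊛ {Q = Q} span-𝟘 q            = span-≐ (≐-sym (⊛-zeroˡ Q)) span-𝟘
span-⊛ (span-atom a) q             = atom-⊛-span a q
span-⊛ {Q = R} (span-⊕ {P} {Q} p q) r = span-≐ (≐-sym (⊛-distribʳ R P Q)) (span-⊕ (span-⊛ p r) (span-⊛ q r))
span-⊛ {Q = Q} (span-≐ e p) q      = span-≐ (⊛-cong {G = Q} {G' = Q} e ≐-refl) (span-⊛ p q)

Rep : Series → Set
Rep P = Σ Poly λ p₀ → Σ ℕ λ k → Σ (Fin k → Poly) λ ps →
  Σ (Fin k → Series) λ Rs → Σ (Fin k → ℕ) λ ds →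
    (∀ i → RTN₁ (Rs i)) × (∀ i → 1 ≤ ds i) ×
    (∀ n → P n ≡ coeff p₀ n + ΣFin k (λ i → polyDil (ps i) (Rs i) (ds i) n))

coeff-span : ∀ p → Span (coeff p)
coeff-span []      = span-≐ (λ n → refl) span-𝟘
coeff-span (a ∷ p) = span-≐ head+tail (span-⊕ (span-scale a (span-atom (monomial 0))) (span-x (coeff-span p)))
  where
  head+tail : (scale a 𝟙 ⊕ xTimes (coeff p)) ≐ coeff (a ∷ p)
  head+tail zero    = trans (+-identityʳ _) (*-identityʳ a)
  head+tail (suc n) = cong (_+ coeff p n) (*-zeroʳ a)

ΣFin-span : ∀ k (f : Fin k → Series) → (∀ i → Span (f i)) → Span (λ n → ΣFin k (λ i → f i n))
ΣFin-span zero    f h = span-≐ (λ n → refl) span-𝟘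
ΣFin-span (suc k) f h = span-⊕ (h zero) (ΣFin-span k (f ∘ suc) (h ∘ suc))

Rep⇒Span : ∀ {P} → Rep P → Span P
Rep⇒Span (p₀ , k , ps , Rs , ds , rs , ds≥1 , eq) =
  span-≐ (λ n → sym (eq n)) (span-⊕ (coeff-span p₀) (ΣFin-span k _ (λ i → span-⊛ (coeff-span (ps i)) (dilate-span (ds i) (ds≥1 i) (rs i)))))
  where
  dilate-span : ∀ {R} d → 1 ≤ d → RTN₁ R → Span (dilate R d)
  dilate-span {R} (suc e) _ r = span-≐ (≐-sym (dilate≐dil R e)) (span-atom (dilated 0 R e (RTN₁⇒RT R r)))

Rep-≐ : ∀ {P Q} → P ≐ Q → Rep P → Rep Q
Rep-≐ e (p₀ , k , ps , Rs , ds , rs , ds≥1 , eq) = p₀ , k , ps , Rs , ds , rs , ds≥1 , λ n → trans (sym (e n)) (eq n)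

monomialPoly : ℕ → Poly
monomialPoly zero    = 1 ∷ []
monomialPoly (suc j) = 0 ∷ monomialPoly j

coeff-monomialPoly : ∀ j → coeff (monomialPoly j) ≐ shift j 𝟙
coeff-monomialPoly zero    zero    = refl
coeff-monomialPoly zero    (suc n) = refl
coeff-monomialPoly (suc j) zero    = refl
coeff-monomialPoly (suc j) (suc n) = coeff-monomialPoly j n

_+ₚ_ : Poly → Poly → Poly
[]      +ₚ q       = q
(a ∷ p) +ₚ []      = a ∷ p
(a ∷ p) +ₚ (b ∷ q) = (a + b) ∷ (p +ₚ q)

coeff-+ₚ : ∀ p q n → coeff (p +ₚ q) n ≡ coeff p n + coeff q n
coeff-+ₚ []      q       n       = refl
coeff-+ₚ (a ∷ p) []      n       = sym (+-identityʳ _)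
coeff-+ₚ (a ∷ p) (b ∷ q) zero    = refl
coeff-+ₚ (a ∷ p) (b ∷ q) (suc n) = coeff-+ₚ p q n

_++ᶠ_ : ∀ {A : Set} {k₁ k₂} → (Fin k₁ → A) → (Fin k₂ → A) → Fin (k₁ + k₂) → A
_++ᶠ_ {k₁ = zero}  f g i       = g i
_++ᶠ_ {k₁ = suc k} f g zero    = f zero
_++ᶠ_ {k₁ = suc k} f g (suc i) = ((f ∘ suc) ++ᶠ g) i

++ᶠ-all : ∀ {A : Set} (Q : A → Set) {k₁ k₂} (f : Fin k₁ → A) (g : Fin k₂ → A) →
  (∀ i → Q (f i)) → (∀ i → Q (g i)) → ∀ i → Q ((f ++ᶠ g) i)
++ᶠ-all Q {zero}  f g hf hg i       = hg i
++ᶠ-all Q {suc k} f g hf hg zero    = hf zero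
++ᶠ-all Q {suc k} f g hf hg (suc i) = ++ᶠ-all Q (f ∘ suc) g (hf ∘ suc) hg i

ΣFin-++ᶠ : ∀ k₁ {k₂} (ps : Fin k₁ → Poly) (ps' : Fin k₂ → Poly) (Rs : Fin k₁ → Series) (Rs' : Fin k₂ → Series)
  (ds : Fin k₁ → ℕ) (ds' : Fin k₂ → ℕ) n →
  ΣFin (k₁ + k₂) (λ i → polyDil ((ps ++ᶠ ps') i) ((Rs ++ᶠ Rs') i) ((ds ++ᶠ ds') i) n)
  ≡ ΣFin k₁ (λ i → polyDil (ps i) (Rs i) (ds i) n) + ΣFin k₂ (λ i → polyDil (ps' i) (Rs' i) (ds' i) n)
ΣFin-++ᶠ zero    ps ps' Rs Rs' ds ds' n = refl
ΣFin-++ᶠ (suc k) ps ps' Rs Rs' ds ds' n =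
  trans (cong (polyDil (ps zero) (Rs zero) (ds zero) n +_) (ΣFin-++ᶠ k (ps ∘ suc) ps' (Rs ∘ suc) Rs' (ds ∘ suc) ds' n))
        (sym (+-assoc (polyDil (ps zero) (Rs zero) (ds zero) n) _ _))

Rep-⊕ : ∀ {P Q} → Rep P → Rep Q → Rep (P ⊕ Q)
Rep-⊕ (p₀ , k , ps , Rs , ds , rs , ds≥1 , eq) (p₀' , k' , ps' , Rs' , ds' , rs' , ds≥1' , eq') =
  p₀ +ₚ p₀' , k + k' , ps ++ᶠ ps' , Rs ++ᶠ Rs' , ds ++ᶠ ds' ,
  ++ᶠ-all RTN₁ Rs Rs' rs rs' , ++ᶠ-all (1 ≤_) ds ds' ds≥1 ds≥1' ,
  λ n → trans (cong₂ _+_ (eq n) (eq' n))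
    (trans (interchange (coeff p₀ n) (ΣFin k (λ i → polyDil (ps i) (Rs i) (ds i) n)) (coeff p₀' n) _)
           (sym (cong₂ _+_ (coeff-+ₚ p₀ p₀' n) (ΣFin-++ᶠ k ps ps' Rs Rs' ds ds' n))))

Atom⇒Rep : ∀ {A} → Atom A → Rep A
Atom⇒Rep (monomial j) = monomialPoly j , 0 , (λ ()) , (λ ()) , (λ ()) , (λ ()) , (λ ()) ,
  λ n → trans (sym (coeff-monomialPoly j n)) (sym (+-identityʳ _))
Atom⇒Rep (dilated j T e r) = [] , 1 , (λ _ → monomialPoly j) , (λ _ → T) , (λ _ → suc e) , (λ _ → RT⇒RTN₁ T r) , (λ _ → s≤s z≤n) ,
  λ n → sym (trans (+-identityʳ _) (atom≐ n))
  where
  atom≐ : polyDil (monomialPoly j) T (suc e) ≐ shift j (dil T e)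
  atom≐ = ≐-trans (⊛-cong (coeff-monomialPoly j) (dilate≐dil T e))
                  (≐-trans (⊛-shiftˡ j 𝟙 (dil T e)) (shift-cong j (⊛-identityˡ _)))

Span⇒Rep : ∀ {P} → Span P → Rep P
Span⇒Rep span-𝟘        = [] , 0 , (λ ()) , (λ ()) , (λ ()) , (λ ()) , (λ ()) , λ n → refl
Span⇒Rep (span-atom a) = Atom⇒Rep a
Span⇒Rep (span-⊕ p q)  = Rep-⊕ (Span⇒Rep p) (Span⇒Rep q)
Span⇒Rep (span-≐ e p)  = Rep-≐ e (Span⇒Rep p)

-- The parts of Lemma 4.7

InS-≐ : ∀ {P Q} → P ≐ Q → InS P → InS Q
InS-≐ e (P₀≡0 , P≢0 , rep) = trans (sym (e 0)) P₀≡0 , (λ Q≡0 → P≢0 (λ n → trans (e n) (Q≡0 n))) , Rep-≐ e rep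

-- A product of nonzero series over ℕ is nonzero: if P n ≠ 0 then
-- P n · Q m is a term of (P·Q)(n+m).
⊛-nonzero : ∀ P Q → ¬ IsZero P → ¬ IsZero Q → ¬ IsZero (P ⊛ Q)
⊛-nonzero P Q P≢0 Q≢0 PQ≡0 = P≢0 P≡0
  where
  P≡0 : ∀ n → P n ≡ 0
  P≡0 n with P n ≟ 0
  ... | yes Pn≡0 = Pn≡0
  ... | no  Pn≢0 = ⊥-elim (Q≢0 Q≡0)
    where
    term≡0 : ∀ m → P n * Q m ≡ 0
    term≡0 m = n≤0⇒n≡0 (≤-trans
      (subst (λ z → P n * Q z ≤ (P ⊛ Q) (n + m)) (m+n∸m≡n n m) (Σ≤-term (n + m) (λ i → P i * Q (n + m ∸ i)) n (m≤m+n n m)))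
      (≤-reflexive (PQ≡0 (n + m))))
    Q≡0 : ∀ m → Q m ≡ 0
    Q≡0 m = [ (λ Pn≡0 → ⊥-elim (Pn≢0 Pn≡0)) , (λ Qm≡0 → Qm≡0) ]′ (m*n≡0⇒m≡0∨n≡0 (P n) (term≡0 m))

InS-xPoly : ∀ p → ¬ IsZero (xTimes (coeff p)) → InS (xTimes (coeff p))
InS-xPoly p nonzero = refl , nonzero , (0 ∷ p) , 0 , (λ ()) , (λ ()) , (λ ()) , (λ ()) , (λ ()) , x·p≡
  where
  x·p≡ : ∀ n → xTimes (coeff p) n ≡ coeff (0 ∷ p) n + 0
  x·p≡ zero    = refl
  x·p≡ (suc n) = sym (+-identityʳ _)

xRTN₁⊆xRTN₁⋆ : ∀ P → InXRTN₁ P → InXRTN₁⋆ P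
xRTN₁⊆xRTN₁⋆ P (R , r , P≐xR) = dilate R 1 , (R , 1 , s≤s z≤n , r , ≐-refl) ,
  ≐-trans P≐xR (xTimes-cong (≐-sym (≐-trans (dilate≐dil R 0) (dil-zero R))))

-- (b) x · RTN₁⋆ ⊆ 𝔖: x · R(x^d) is a single atom, nonzero as R is
-- eventually positive.
xRTN₁⋆⊆S : ∀ P → InXRTN₁⋆ P → InS P
xRTN₁⋆⊆S P (_ , (R , suc e , _ , r@((N , pos) , _) , R'≐) , P≐) =
  P≐ 0 , nonzero , Span⇒Rep (span-≐ atom≐P (span-atom (dilated 1 R e (RTN₁⇒RT R r))))
  where
  atom≐P : shift 1 (dil R e) ≐ P
  atom≐P = ≐-sym (≐-trans P≐ (xTimes-cong (≐-trans R'≐ (dilate≐dil R e))))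
  nonzero : ¬ IsZero P
  nonzero P≡0 = <-irrefl refl
    (subst (0 <_) (trans (sym (dil-multiple R e N)) (trans (atom≐P (suc (N * suc e))) (P≡0 _))) (pos N ≤-refl))

x∈S : InS xSeries
x∈S = InS-≐ x≐ (InS-xPoly (1 ∷ []) (λ x≡0 → 1≢0 (x≡0 1)))
  where
  1≢0 : ¬ (1 ≡ 0)
  1≢0 ()
  x≐ : xTimes (coeff (1 ∷ [])) ≐ xSeries
  x≐ zero          = refl
  x≐ (suc zero)    = refl
  x≐ (suc (suc n)) = refl

RTN₁-one : RTN₁ (λ _ → 1)
RTN₁-one = RT⇒RTN₁ _ ((0 , λ _ _ → s≤s z≤n) , λ k → 0 , λ m _ → m≤n+m (k * 1) 1 , m≤n+m (k * 1) 1)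

-- (c) x/(1-x^m) = x · 1(x^m) ∈ 𝔖, as an instance of (b).
geomX∈S : ∀ m → 1 ≤ m → InS (geomX m)
geomX∈S m m≥1 = xRTN₁⋆⊆S (geomX m) (dilate (λ _ → 1) m , ((λ _ → 1) , m , m≥1 , RTN₁-one , ≐-refl) , ≐-refl)

S-scale : ∀ c P → 1 ≤ c → InS P → InS (scale c P)
S-scale (suc c) P _ (P₀≡0 , P≢0 , rep) =
  trans (cong (suc c *_) P₀≡0) (*-zeroʳ (suc c)) ,
  (λ cP≡0 → P≢0 (λ n → m*n≡0⇒m≡0 (P n) (suc c) (trans (*-comm (P n) (suc c)) (cP≡0 n)))) ,
  Span⇒Rep (span-scale (suc c) (Rep⇒Span rep))

S-⊕ : ∀ P Q → InS P → InS Q → InS (P ⊕ Q)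
S-⊕ P Q (P₀≡0 , P≢0 , repP) (Q₀≡0 , _ , repQ) =
  cong₂ _+_ P₀≡0 Q₀≡0 , (λ PQ≡0 → P≢0 (λ n → m+n≡0⇒m≡0 (P n) (PQ≡0 n))) , Rep-⊕ repP repQ

S-⊛ : ∀ P Q → InS P → InS Q → InS (P ⊛ Q)
S-⊛ P Q (P₀≡0 , P≢0 , repP) (_ , Q≢0 , repQ) =
  cong (_* Q 0) P₀≡0 , ⊛-nonzero P Q P≢0 Q≢0 , Span⇒Rep (span-⊛ (Rep⇒Span repP) (Rep⇒Span repQ))

lemma4p7 : (∀ (p : Poly) → ¬ IsZero (xTimes (coeff p)) → InS (xTimes (coeff p)))
    × (∀ (P : Series) → InXRTN₁ P → InXRTN₁⋆ P)
    × (∀ (P : Series) → InXRTN₁⋆ P → InS P)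
    × InS xSeries
    × (∀ (m : ℕ) → 1 ≤ m → InS (geomX m))
    × (∀ (c : ℕ) (P : Series) → 1 ≤ c → InS P → InS (scale c P))
    × (∀ (P Q : Series) → InS P → InS Q → InS (P ⊕ Q))
    × (∀ (P Q : Series) → InS P → InS Q → InS (P ⊛ Q))
lemma4p7 = InS-xPoly , xRTN₁⊆xRTN₁⋆ , xRTN₁⋆⊆S , x∈S , geomX∈S , S-scale , S-⊕ , S-⊛
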